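{- Let $r$ be a positive integer with $r \equiv 2 \pmod 4$, let $\ell = \binom{2r+1}{r}$ (which is even), and construct the graph $G$ with terminal set $Q = Q_0 \cup \{x\}$ as described in the context, with parameter $\alpha > r^2 \ell |W|$. Let $S \subseteq Q$ be important and let $S_0 = S \setminus \{x\}$. Then for every vertex set $A \subseteq V(G)$ with $S \subseteq A$ and $(Q\setminus S) \cap A = \emptyset$ that minimizes the total cost of edges with exactly one endpoint in $A$, and for every $w_Z \in W$, we have $w_Z \in A$ if and only if $u_{S_0} \in Z$.
   Context: Construction: $Q_0$ is a set of $2r+1$ terminals. $U = \{u_{S'} : S' \subseteq Q_0, |S'| = r\}$ is a set of $\ell = \binom{2r+1}{r}$ non-terminal vertices. Each $u_{S'}$ is joined to every $q \in Q_0 \setminus S'$ by an edge of cost $\alpha$ and to every $q \in S'$ by an edge of cost $(1+\frac1r+\frac1{r^2})\alpha$. $x$ is one further terminal, $Q = Q_0 \cup \{x\}$. $W = \{w_Z : Z \subseteq U, |Z| = \ell/2\}$ is a set of non-terminal vertices. For every $u_{S'} \in U$ and $w_Z \in W$ there is an edge $u_{S'}w_Z$ of cost $1$ if $u_{S'} \in Z$ and cost $0$ otherwise. Every $w_Z$ is joined to $x$ by an edge of cost $\ell/2 - 1$. There are no other edges. A set $S \subseteq Q$ is important if $x \in S$ and $|S| = r+1$.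
   Formalization: The parameter α ranges over the rationals. -}

module Defs where

open import Data.Bool using (Bool; true; false; _xor_; if_then_else_)
open import Data.Nat using (ℕ; zero; suc; _*_; _∸_; NonZero; _≟_)
import Data.Nat.DivMod as ℕD
open import Data.Nat.Combinatorics using (_C_)
open import Data.Fin using (Fin)
open import Data.Fin.Subset using (Subset; ∣_∣; _∈_; _∉_)
open import Data.Vec using (Vec; []; _∷_)
import Data.Vec as Vec
open import Data.List using (List; []; _∷_; _++_; map; length; allFin; foldr; lookup)
open import Data.Integer using (+_)
open import Data.Rational using (ℚ; 0ℚ; 1ℚ; _/_) renaming (_+_ to _+ℚ_; _*_ to _*ℚ_)
open import Data.Product using (Σ; _,_; proj₁; _×_)
open import Relation.Nullary using (yes; no)
open import Relation.Binary.PropositionalEquality using (_≡_)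

allSubsets : (m : ℕ) → List (Subset m)
allSubsets zero = [] ∷ []
allSubsets (suc m) = map (true ∷_) (allSubsets m) ++ map (false ∷_) (allSubsets m)

ofSize : {m : ℕ} (k : ℕ) → List (Subset m) → List (Σ (Subset m) (λ Z → ∣ Z ∣ ≡ k))
ofSize k [] = []
ofSize k (Z ∷ Zs) with ∣ Z ∣ ≟ k
... | yes p = (Z , p) ∷ ofSize k Zs
... | no _ = ofSize k Zs

-- |Q₀| = 2r+1 ; Q₀ is Fin (qsize r)
qsize : ℕ → ℕ
qsize r = suc (2 * r)

-- the r-subsets S' of Q₀ (indexing the vertices u_{S'} of U)
Ulist : (r : ℕ) → List (Σ (Subset (qsize r)) (λ S' → ∣ S' ∣ ≡ r))
Ulist r = ofSize r (allSubsets (qsize r))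

-- number of U-vertices (= ℓ); U-vertices are Fin (Ucount r)
Ucount : ℕ → ℕ
Ucount r = length (Ulist r)

uset : (r : ℕ) → Fin (Ucount r) → Subset (qsize r)
uset r i = proj₁ (lookup (Ulist r) i)

ℓ : ℕ → ℕ
ℓ r = qsize r C r

half : ℕ → ℕ
half m = m ℕD./ 2

WVert : ℕ → Set
WVert r = Σ (Subset (Ucount r)) (λ Z → ∣ Z ∣ ≡ half (ℓ r))

Wlist : (r : ℕ) → List (WVert r)
Wlist r = ofSize (half (ℓ r)) (allSubsets (Ucount r))

data Vertex (r : ℕ) : Set where
  qv : Fin (qsize r) → Vertex r
  xv : Vertex r
  uv : Fin (Ucount r) → Vertex r
  wv : WVert r → Vertex r

ℕtoℚ : ℕ → ℚ
ℕtoℚ k = + k / 1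

sumℚ : List ℚ → ℚ
sumℚ = foldr _+ℚ_ 0ℚ

cross : Bool → Bool → ℚ → ℚ
cross a b c = if a xor b then c else 0ℚ

cutCost : (r : ℕ) .{{_ : NonZero r}} → (α : ℚ) → (Vertex r → Bool) → ℚ
cutCost r α A =
    sumℚ (map (λ i → sumℚ (map (λ q → cross (A (uv i)) (A (qv q)) (cUQ i q)) (allFin (qsize r)))) (allFin (Ucount r)))
  +ℚ sumℚ (map (λ i → sumℚ (map (λ W → cross (A (uv i)) (A (wv W)) (cUW i W)) (Wlist r))) (allFin (Ucount r)))
  +ℚ sumℚ (map (λ W → cross (A (wv W)) (A xv) (ℕtoℚ (half (ℓ r) ∸ 1))) (Wlist r))
  where
    invr : ℚ
    invr = + 1 / r
    cUQ : Fin (Ucount r) → Fin (qsize r) → ℚ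
    cUQ i q = if Vec.lookup (uset r i) q then (1ℚ +ℚ invr +ℚ invr *ℚ invr) *ℚ α else α
    cUW : Fin (Ucount r) → WVert r → ℚ
    cUW i W = if Vec.lookup (proj₁ W) i then 1ℚ else 0ℚ

Feasible : (r : ℕ) → Subset (qsize r) → (Vertex r → Bool) → Set
Feasible r S₀ A = (A xv ≡ true)
                × ((q : Fin (qsize r)) → q ∈ S₀ → A (qv q) ≡ true)
                × ((q : Fin (qsize r)) → q ∉ S₀ → A (qv q) ≡ false)

module Submission where

-- Minimality is tested by toggling one vertex, which changes only the cost of the edges at
-- that vertex.  Inside A, u_{S₀} is cut from the r+1 edges of cost α to Q₀ ∖ S₀; outside,
-- from the r edges of cost (1 + 1/r + 1/r²)α to S₀.  Inside is cheaper by α/r, more than the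
-- total weight |W| of its edges to W, so u_{S₀} ∈ A.  Any other u_{S'} meets S₀ in at most
-- r - 1 terminals and is by the same count at least α/r² > |W| cheaper outside A.  With
-- u_{S₀} the only U-vertex in A, w_Z costs |Z| - [u_{S₀} ∈ Z] inside A and
-- [u_{S₀} ∈ Z] + |Z| - 1 outside, so it lies in A exactly when u_{S₀} ∈ Z.

open import Defs

module Lemmas where
  open import Data.Bool as Bool using (Bool; true; false; not; _xor_; _∧_; if_then_else_)
  open import Data.Nat as ℕ using (ℕ; zero; suc; _∸_)
  import Data.Nat.Properties as ℕ
  import Data.Nat.Coprimality as Coprime
  open import Data.Nat.Combinatorics using (_C_; nCk+nC[k+1]≡[n+1]C[k+1])
  open import Data.Nat.DivMod using (/-monoˡ-≤)
  open import Data.Integer as ℤ using (1ℤ)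
  import Data.Integer.Properties as ℤ
  open import Data.Rational hiding (∣_∣)
  open import Data.Rational.Properties
  import Data.Rational.Unnormalised as ℚᵘ
  import Data.Rational.Unnormalised.Properties as ℚᵘ
  open import Data.Fin as Fin using (Fin; zero; suc)
  open import Data.Fin.Subset using (Subset; ∣_∣; _∩_; ∁)
  open import Data.Fin.Subset.Properties using (∣p∩q∣≤∣p∣; ∣p∩q∣≤∣q∣; ∣∁p∣≡n∸∣p∣; ∣⊥∣≡0; ∩-inverseʳ; ∩-idem)
  open import Data.Vec using ([]; _∷_; lookup)
  import Data.Vec.Properties as Vec
  open import Data.List as List using (List; []; _∷_; _++_; map; allFin; length)
  import Data.List.Properties as List
  open import Data.List.Membership.Propositional using () renaming (_∈_ to _∈ₗ_)
  open import Data.List.Membership.Propositional.Properties using (∈-allFin; ∈-map⁺; ∈-map⁻; ∈-++⁺ˡ; ∈-++⁺ʳ; ∈-lookup)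
  open import Data.List.Relation.Unary.Any using (here; there)
  open import Data.List.Relation.Unary.All as All using (All; []; _∷_)
  open import Data.List.Relation.Unary.Unique.Propositional using (Unique; []; _∷_)
  import Data.List.Relation.Unary.Unique.Propositional.Properties as Unique
  open import Data.List.Relation.Binary.Disjoint.Propositional using (Disjoint)
  open import Data.Maybe using (Maybe; just; nothing)
  open import Data.Product using (Σ; _,_; proj₁; proj₂)
  open import Function using (_∘_; id)
  open import Level using (0ℓ)
  open import Relation.Binary.Definitions using (DecidableEquality)
  open import Relation.Binary.PropositionalEquality
  open import Relation.Nullary using (yes; no; contradiction; map′)
  open import Tactic.RingSolver using (solve-∀)
  import Tactic.RingSolver.Core.AlmostCommutativeRing as ACR

  private variable
    A : Set
    n : ℕ

  ℚ-ring : ACR.AlmostCommutativeRing 0ℓ 0ℓ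
  ℚ-ring = ACR.fromCommutativeRing +-*-commutativeRing 0≟
    where
    0≟ : ∀ p → Maybe (0ℚ ≡ p)
    0≟ p with 0ℚ ≟ p
    ... | yes 0≡p = just 0≡p
    ... | no _ = nothing

  ℕtoℚ-suc : ∀ k → ℕtoℚ (suc k) ≡ 1ℚ + ℕtoℚ k
  ℕtoℚ-suc k = toℚᵘ-injective (begin
    toℚᵘ (ℕtoℚ (suc k))                ≈⟨ toℚᵘ-fromℚᵘ (ℚᵘ.mkℚᵘ (ℤ.+ suc k) 0) ⟩
    ℚᵘ.mkℚᵘ (ℤ.+ suc k) 0              ≈⟨ ℚᵘ.*≡* (cong (λ z → (ℤ.+ 1 ℤ.+ z) ℤ.* ℤ.+ 1) (ℤ.*-identityʳ (ℤ.+ k))) ⟨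
    ℚᵘ.1ℚᵘ ℚᵘ.+ ℚᵘ.mkℚᵘ (ℤ.+ k) 0      ≈⟨ ℚᵘ.+-cong (toℚᵘ-fromℚᵘ ℚᵘ.1ℚᵘ) (toℚᵘ-fromℚᵘ (ℚᵘ.mkℚᵘ (ℤ.+ k) 0)) ⟨
    toℚᵘ 1ℚ ℚᵘ.+ toℚᵘ (ℕtoℚ k)         ≈⟨ toℚᵘ-homo-+ 1ℚ (ℕtoℚ k) ⟨
    toℚᵘ (1ℚ + ℕtoℚ k)                 ∎)
    where open ℚᵘ.≃-Reasoning

  ℕtoℚ-+ : ∀ m n → ℕtoℚ (m ℕ.+ n) ≡ ℕtoℚ m + ℕtoℚ n
  ℕtoℚ-+ zero n = sym (+-identityˡ (ℕtoℚ n))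
  ℕtoℚ-+ (suc m) n rewrite ℕtoℚ-suc (m ℕ.+ n) | ℕtoℚ-suc m | ℕtoℚ-+ m n = sym (+-assoc 1ℚ (ℕtoℚ m) (ℕtoℚ n))

  ℕtoℚ-* : ∀ m n → ℕtoℚ (m ℕ.* n) ≡ ℕtoℚ m * ℕtoℚ n
  ℕtoℚ-* zero n = sym (*-zeroˡ (ℕtoℚ n))
  ℕtoℚ-* (suc m) n rewrite ℕtoℚ-+ n (m ℕ.* n) | ℕtoℚ-suc m | ℕtoℚ-* m n = distrib (ℕtoℚ m) (ℕtoℚ n)
    where
    distrib : ∀ m n → n + m * n ≡ (1ℚ + m) * n
    distrib = solve-∀ ℚ-ring

  0≤ℕtoℚ : ∀ k → 0ℚ ≤ ℕtoℚ k
  0≤ℕtoℚ zero = ≤-refl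
  0≤ℕtoℚ (suc k) rewrite ℕtoℚ-suc k = +-mono-≤ (nonNegative⁻¹ 1ℚ) (0≤ℕtoℚ k)

  ℕtoℚ-mono-≤ : ∀ {m n} → m ℕ.≤ n → ℕtoℚ m ≤ ℕtoℚ n
  ℕtoℚ-mono-≤ {m} {n} m≤n = begin
    ℕtoℚ m                    ≡⟨ +-identityʳ (ℕtoℚ m) ⟨
    ℕtoℚ m + 0ℚ               ≤⟨ +-monoʳ-≤ (ℕtoℚ m) (0≤ℕtoℚ (n ℕ.∸ m)) ⟩
    ℕtoℚ m + ℕtoℚ (n ℕ.∸ m)   ≡⟨ ℕtoℚ-+ m (n ℕ.∸ m) ⟨
    ℕtoℚ (m ℕ.+ (n ℕ.∸ m))    ≡⟨ cong ℕtoℚ (ℕ.m+[n∸m]≡n m≤n) ⟩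
    ℕtoℚ n                    ∎
    where open ≤-Reasoning

  ℕtoℚ-*-inverse : ∀ k → ℕtoℚ (suc k) * (1ℤ / suc k) ≡ 1ℚ
  ℕtoℚ-*-inverse k
    rewrite normalize-coprime (Coprime.sym (Coprime.1-coprimeTo (suc k)))
          | normalize-coprime {1} {k} (Coprime.1-coprimeTo (suc k)) =
    *-inverseʳ (mkℚ (ℤ.+ suc k) 0 (Coprime.sym (Coprime.1-coprimeTo (suc k))))

  0≤* : ∀ {p q} → 0ℚ ≤ p → 0ℚ ≤ q → 0ℚ ≤ p * q
  0≤* {p} {q} 0≤p 0≤q = nonNegative⁻¹ (p * q) {{nonNeg*nonNeg⇒nonNeg p {{nonNegative 0≤p}} q {{nonNegative 0≤q}}}}

  p<1+p : ∀ p → p < 1ℚ + p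
  p<1+p p = begin-strict
    p          ≡⟨ +-identityˡ p ⟨
    0ℚ + p     <⟨ +-monoˡ-< p (positive⁻¹ 1ℚ) ⟩
    1ℚ + p     ∎
    where open ≤-Reasoning

  c≤c+[y-x]⇒x≤y : ∀ {c x y} → c ≤ c + (y - x) → x ≤ y
  c≤c+[y-x]⇒x≤y {c} {x} {y} c≤c+y-x = begin
    x                        ≡⟨ e₁ c x ⟩
    c + (x - c)              ≤⟨ +-monoˡ-≤ (x - c) c≤c+y-x ⟩
    c + (y - x) + (x - c)    ≡⟨ e₂ c x y ⟩
    y                        ∎
    where
    open ≤-Reasoning
    e₁ : ∀ c x → x ≡ c + (x - c)
    e₁ = solve-∀ ℚ-ring
    e₂ : ∀ c x y → c + (y - x) + (x - c) ≡ y
    e₂ = solve-∀ ℚ-ring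

  minimal-side : ∀ (f : Bool → ℚ) a b → f a ≤ f (not a) → f b < f (not b) → a ≡ b
  minimal-side f true true _ _ = refl
  minimal-side f false false _ _ = refl
  minimal-side f true false fa≤ fb< = contradiction (<-≤-trans fb< fa≤) (<-irrefl refl)
  minimal-side f false true fa≤ fb< = contradiction (<-≤-trans fb< fa≤) (<-irrefl refl)

  sumFin : (Fin n → ℚ) → ℚ
  sumFin {n} f = sumℚ (map f (allFin n))

  sum-cong : ∀ {f g : A → ℚ} → (∀ x → f x ≡ g x) → ∀ xs → sumℚ (map f xs) ≡ sumℚ (map g xs)
  sum-cong f≗g xs = cong sumℚ (List.map-cong f≗g xs)

  sum-+ : ∀ (f g : A → ℚ) xs → sumℚ (map (λ x → f x + g x) xs) ≡ sumℚ (map f xs) + sumℚ (map g xs)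
  sum-+ f g [] = refl
  sum-+ f g (x ∷ xs) rewrite sum-+ f g xs = shuffle (f x) (g x) (sumℚ (map f xs)) (sumℚ (map g xs))
    where
    shuffle : ∀ a b c d → (a + b) + (c + d) ≡ (a + c) + (b + d)
    shuffle = solve-∀ ℚ-ring

  sum-minus : ∀ (f g : A → ℚ) xs → sumℚ (map (λ x → f x - g x) xs) ≡ sumℚ (map f xs) - sumℚ (map g xs)
  sum-minus f g [] = refl
  sum-minus f g (x ∷ xs) rewrite sum-minus f g xs = shuffle (f x) (g x) (sumℚ (map f xs)) (sumℚ (map g xs))
    where
    shuffle : ∀ a b c d → (a - b) + (c - d) ≡ (a + c) - (b + d)
    shuffle = solve-∀ ℚ-ring

  sum-const : ∀ (c : ℚ) (xs : List A) → sumℚ (map (λ _ → c) xs) ≡ ℕtoℚ (length xs) * c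
  sum-const c [] = sym (*-zeroˡ c)
  sum-const c (x ∷ xs) rewrite sum-const c xs | ℕtoℚ-suc (length xs) = distrib (ℕtoℚ (length xs)) c
    where
    distrib : ∀ m c → c + m * c ≡ (1ℚ + m) * c
    distrib = solve-∀ ℚ-ring

  sum-mono-≤ : ∀ {f g : A → ℚ} → (∀ x → f x ≤ g x) → ∀ xs → sumℚ (map f xs) ≤ sumℚ (map g xs)
  sum-mono-≤ f≤g [] = ≤-refl
  sum-mono-≤ f≤g (x ∷ xs) = +-mono-≤ (f≤g x) (sum-mono-≤ f≤g xs)

  sum-update : ∀ {f g : A → ℚ} {x xs} → Unique xs → x ∈ₗ xs → (∀ y → y ≢ x → f y ≡ g y) →
               sumℚ (map f xs) ≡ sumℚ (map g xs) + (f x - g x)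
  sum-update {f = f} {g} {xs = x ∷ xs} (x∉xs ∷ _) (here refl) f≗g
    rewrite cong sumℚ (List.map-cong-local (All.map (λ x≢y → f≗g _ (x≢y ∘ sym)) x∉xs)) =
    shuffle (f x) (g x) (sumℚ (map g xs))
    where
    shuffle : ∀ a b s → a + s ≡ (b + s) + (a - b)
    shuffle = solve-∀ ℚ-ring
  sum-update {f = f} {g} {xs = y ∷ ys} (y∉ys ∷ uniq) (there x∈ys) f≗g
    rewrite f≗g y (All.lookup y∉ys x∈ys) | sum-update uniq x∈ys f≗g =
    sym (+-assoc (g y) _ _)

  sumFin-suc : ∀ (f : Fin (suc n) → ℚ) → sumFin f ≡ f zero + sumFin (f ∘ suc)
  sumFin-suc f = cong (λ xs → f zero + sumℚ xs) (trans (List.map-tabulate suc f) (sym (List.map-tabulate id (f ∘ suc))))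

  sumFin-select : ∀ (u : Subset n) (x : ℚ) → sumFin (λ q → if lookup u q then x else 0ℚ) ≡ ℕtoℚ ∣ u ∣ * x
  sumFin-select [] x = sym (*-zeroˡ x)
  sumFin-select (true ∷ u) x = begin
    sumFin (λ q → if lookup (true ∷ u) q then x else 0ℚ)   ≡⟨ sumFin-suc (λ q → if lookup (true ∷ u) q then x else 0ℚ) ⟩
    x + sumFin (λ q → if lookup u q then x else 0ℚ)        ≡⟨ cong (x +_) (sumFin-select u x) ⟩
    x + ℕtoℚ ∣ u ∣ * x                                     ≡⟨ distrib (ℕtoℚ ∣ u ∣) x ⟩
    (1ℚ + ℕtoℚ ∣ u ∣) * x                                  ≡⟨ cong (_* x) (ℕtoℚ-suc ∣ u ∣) ⟨
    ℕtoℚ (suc ∣ u ∣) * x                                   ∎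
    where
    open ≡-Reasoning
    distrib : ∀ m c → c + m * c ≡ (1ℚ + m) * c
    distrib = solve-∀ ℚ-ring
  sumFin-select (false ∷ u) x =
    trans (sumFin-suc (λ q → if lookup (false ∷ u) q then x else 0ℚ)) (trans (+-identityˡ _) (sumFin-select u x))

  sumFin-if-if : ∀ (u s : Subset n) (x y : ℚ) →
    sumFin (λ q → if lookup u q then (if lookup s q then x + y else x) else 0ℚ) ≡ ℕtoℚ ∣ u ∣ * x + ℕtoℚ ∣ s ∩ u ∣ * y
  sumFin-if-if {n} u s x y = begin
    sumFin (λ q → if lookup u q then (if lookup s q then x + y else x) else 0ℚ)
      ≡⟨ sum-cong (λ q → split (lookup u q) (lookup s q)) (allFin n) ⟩
    sumFin (λ q → (if lookup u q then x else 0ℚ) + (if lookup s q ∧ lookup u q then y else 0ℚ))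
      ≡⟨ sum-+ _ _ (allFin n) ⟩
    sumFin (λ q → if lookup u q then x else 0ℚ) + sumFin (λ q → if lookup s q ∧ lookup u q then y else 0ℚ)
      ≡⟨ cong (sumFin (λ q → if lookup u q then x else 0ℚ) +_) (sum-cong (λ q → cong (λ b → if b then y else 0ℚ) (sym (Vec.lookup-zipWith _∧_ q s u))) (allFin n)) ⟩
    sumFin (λ q → if lookup u q then x else 0ℚ) + sumFin (λ q → if lookup (s ∩ u) q then y else 0ℚ)
      ≡⟨ cong₂ _+_ (sumFin-select u x) (sumFin-select (s ∩ u) y) ⟩
    ℕtoℚ ∣ u ∣ * x + ℕtoℚ ∣ s ∩ u ∣ * y ∎
    where
    open ≡-Reasoning
    split : ∀ a b → (if a then (if b then x + y else x) else 0ℚ) ≡ (if a then x else 0ℚ) + (if b ∧ a then y else 0ℚ)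
    split true true = refl
    split true false = sym (+-identityʳ x)
    split false true = refl
    split false false = refl

  0≤cross : ∀ a b {c} → 0ℚ ≤ c → 0ℚ ≤ cross a b c
  0≤cross a b 0≤c with a xor b
  ... | true = 0≤c
  ... | false = ≤-refl

  cross≤ : ∀ a b {c} → 0ℚ ≤ c → cross a b c ≤ c
  cross≤ a b 0≤c with a xor b
  ... | true = ≤-refl
  ... | false = 0≤c

  ∣p∩q∣≡∣p∣≡∣q∣⇒p≡q : ∀ (p q : Subset n) → ∣ p ∩ q ∣ ≡ ∣ p ∣ → ∣ p ∩ q ∣ ≡ ∣ q ∣ → p ≡ q
  ∣p∩q∣≡∣p∣≡∣q∣⇒p≡q [] [] _ _ = refl
  ∣p∩q∣≡∣p∣≡∣q∣⇒p≡q (true ∷ p) (true ∷ q) eqp eqq =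
    cong (true ∷_) (∣p∩q∣≡∣p∣≡∣q∣⇒p≡q p q (ℕ.suc-injective eqp) (ℕ.suc-injective eqq))
  ∣p∩q∣≡∣p∣≡∣q∣⇒p≡q (true ∷ p) (false ∷ q) eqp _ = contradiction eqp (ℕ.<⇒≢ (ℕ.s≤s (∣p∩q∣≤∣p∣ p q)))
  ∣p∩q∣≡∣p∣≡∣q∣⇒p≡q (false ∷ p) (true ∷ q) _ eqq = contradiction eqq (ℕ.<⇒≢ (ℕ.s≤s (∣p∩q∣≤∣q∣ p q)))
  ∣p∩q∣≡∣p∣≡∣q∣⇒p≡q (false ∷ p) (false ∷ q) eqp eqq = cong (false ∷_) (∣p∩q∣≡∣p∣≡∣q∣⇒p≡q p q eqp eqq)

  ∣p∩q∣<∣p∣ : ∀ (p q : Subset n) → ∣ p ∣ ≡ ∣ q ∣ → p ≢ q → ∣ p ∩ q ∣ ℕ.< ∣ p ∣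
  ∣p∩q∣<∣p∣ p q ∣p∣≡∣q∣ p≢q = ℕ.≤∧≢⇒< (∣p∩q∣≤∣p∣ p q)
    (λ eq → p≢q (∣p∩q∣≡∣p∣≡∣q∣⇒p≡q p q eq (trans eq ∣p∣≡∣q∣)))

  0<nCk : ∀ {n k} → k ℕ.≤ n → 0 ℕ.< n C k
  0<nCk {k = zero} _ = ℕ.s≤s ℕ.z≤n
  0<nCk {suc n} {suc k} (ℕ.s≤s k≤n) = begin-strict
    0                      <⟨ 0<nCk k≤n ⟩
    n C k                  ≤⟨ ℕ.m≤m+n (n C k) (n C suc k) ⟩
    n C k ℕ.+ n C suc k    ≡⟨ nCk+nC[k+1]≡[n+1]C[k+1] n k ⟩
    suc n C suc k          ∎
    where open ℕ.≤-Reasoning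

  2≤ℓ : ∀ r → 2 ℕ.≤ ℓ (suc r)
  2≤ℓ r = begin
    2                                          ≤⟨ ℕ.+-mono-≤ (0<nCk (ℕ.≤-trans (ℕ.n≤1+n r) (ℕ.m≤m+n (suc r) _))) (0<nCk (ℕ.m≤m+n (suc r) _)) ⟩
    2 ℕ.* suc r C r ℕ.+ 2 ℕ.* suc r C suc r    ≡⟨ nCk+nC[k+1]≡[n+1]C[k+1] (2 ℕ.* suc r) r ⟩
    ℓ (suc r)                                  ∎
    where open ℕ.≤-Reasoning

  Unique⇒lookup-injective : ∀ {A : Set} {xs : List A} → Unique xs → ∀ i j → List.lookup xs i ≡ List.lookup xs j → i ≡ j
  Unique⇒lookup-injective (x∉xs ∷ _) zero zero _ = refl
  Unique⇒lookup-injective (x∉xs ∷ _) zero (suc j) eq = contradiction eq (All.lookup x∉xs (∈-lookup j))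
  Unique⇒lookup-injective (x∉xs ∷ _) (suc i) zero eq = contradiction (sym eq) (All.lookup x∉xs (∈-lookup i))
  Unique⇒lookup-injective (_ ∷ uniq) (suc i) (suc j) eq = cong suc (Unique⇒lookup-injective uniq i j eq)

  Sized : ℕ → ℕ → Set
  Sized m k = Σ (Subset m) (λ Z → ∣ Z ∣ ≡ k)

  Sized-≡ : ∀ {m k} {Z Y : Sized m k} → proj₁ Z ≡ proj₁ Y → Z ≡ Y
  Sized-≡ {Z = Z , p} {.Z , q} refl = cong (Z ,_) (ℕ.≡-irrelevant p q)

  Sized-≟ : ∀ {m k} → DecidableEquality (Sized m k)
  Sized-≟ Z Y = map′ Sized-≡ (cong proj₁) (Vec.≡-dec Bool._≟_ (proj₁ Z) (proj₁ Y))

  allSubsets-unique : ∀ m → Unique (allSubsets m)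
  allSubsets-unique zero = [] ∷ []
  allSubsets-unique (suc m) =
    Unique.++⁺ (Unique.map⁺ Vec.∷-injectiveʳ uniq) (Unique.map⁺ Vec.∷-injectiveʳ uniq) disjoint
    where
    uniq : Unique (allSubsets m)
    uniq = allSubsets-unique m
    disjoint : Disjoint (map (true ∷_) (allSubsets m)) (map (false ∷_) (allSubsets m))
    disjoint (v∈T , v∈F) with ∈-map⁻ (true ∷_) v∈T | ∈-map⁻ (false ∷_) v∈F
    ... | _ , _ , refl | _ , _ , ()

  ∈-allSubsets : ∀ {m} (Z : Subset m) → Z ∈ₗ allSubsets m
  ∈-allSubsets [] = here refl
  ∈-allSubsets (true ∷ Z) = ∈-++⁺ˡ (∈-map⁺ (true ∷_) (∈-allSubsets Z))
  ∈-allSubsets (false ∷ Z) = ∈-++⁺ʳ _ (∈-map⁺ (false ∷_) (∈-allSubsets Z))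

  module _ {m : ℕ} (k : ℕ) where

    ofSize-All : ∀ {P : Subset m → Set} {Zs} → All P Zs → All (P ∘ proj₁) (ofSize k Zs)
    ofSize-All {Zs = []} [] = []
    ofSize-All {Zs = Z ∷ Zs} (pZ ∷ pZs) with ∣ Z ∣ ℕ.≟ k
    ... | yes _ = pZ ∷ ofSize-All pZs
    ... | no _ = ofSize-All pZs

    ofSize-unique : ∀ {Zs} → Unique Zs → Unique (ofSize k Zs)
    ofSize-unique {[]} [] = []
    ofSize-unique {Z ∷ Zs} (Z∉Zs ∷ uniq) with ∣ Z ∣ ℕ.≟ k
    ... | yes _ = All.map (_∘ cong proj₁) (ofSize-All Z∉Zs) ∷ ofSize-unique uniq
    ... | no _ = ofSize-unique uniq

    ∈-ofSize : ∀ {Z : Subset m} {Zs} → Z ∈ₗ Zs → (p : ∣ Z ∣ ≡ k) → (Z , p) ∈ₗ ofSize k Zs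
    ∈-ofSize {Zs = Y ∷ Zs} (here refl) p with ∣ Y ∣ ℕ.≟ k
    ... | yes _ = here (Sized-≡ refl)
    ... | no ¬p = contradiction p ¬p
    ∈-ofSize {Zs = Y ∷ Zs} (there Z∈Zs) p with ∣ Y ∣ ℕ.≟ k
    ... | yes _ = there (∈-ofSize Z∈Zs p)
    ... | no _ = ∈-ofSize Z∈Zs p

    length-ofSize-++ : ∀ (Zs Ys : List (Subset m)) →
                       length (ofSize k (Zs ++ Ys)) ≡ length (ofSize k Zs) ℕ.+ length (ofSize k Ys)
    length-ofSize-++ [] Ys = refl
    length-ofSize-++ (Z ∷ Zs) Ys with ∣ Z ∣ ℕ.≟ k
    ... | yes _ = cong suc (length-ofSize-++ Zs Ys)
    ... | no _ = length-ofSize-++ Zs Ys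

    length-ofSize-false∷ : ∀ (Zs : List (Subset m)) → length (ofSize k (map (false ∷_) Zs)) ≡ length (ofSize k Zs)
    length-ofSize-false∷ [] = refl
    length-ofSize-false∷ (Z ∷ Zs) with ∣ Z ∣ ℕ.≟ k
    ... | yes _ = cong suc (length-ofSize-false∷ Zs)
    ... | no _ = length-ofSize-false∷ Zs

    length-ofSize-true∷ : ∀ (Zs : List (Subset m)) → length (ofSize (suc k) (map (true ∷_) Zs)) ≡ length (ofSize k Zs)
    length-ofSize-true∷ [] = refl
    length-ofSize-true∷ (Z ∷ Zs) with ∣ Z ∣ ℕ.≟ k | suc ∣ Z ∣ ℕ.≟ suc k
    ... | yes _ | yes _ = cong suc (length-ofSize-true∷ Zs)
    ... | yes p | no ¬p = contradiction (cong suc p) ¬p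
    ... | no ¬p | yes p = contradiction (ℕ.suc-injective p) ¬p
    ... | no _ | no _ = length-ofSize-true∷ Zs

  length-ofSize-0-true∷ : ∀ {m} (Zs : List (Subset m)) → length (ofSize 0 (map (true ∷_) Zs)) ≡ 0
  length-ofSize-0-true∷ [] = refl
  length-ofSize-0-true∷ (Z ∷ Zs) = length-ofSize-0-true∷ Zs

  length-ofSize-allSubsets : ∀ m k → length (ofSize k (allSubsets m)) ≡ m C k
  length-ofSize-allSubsets zero zero = refl
  length-ofSize-allSubsets zero (suc k) = refl
  length-ofSize-allSubsets (suc m) zero
    rewrite length-ofSize-++ 0 (map (true ∷_) (allSubsets m)) (map (false ∷_) (allSubsets m))
          | length-ofSize-0-true∷ (allSubsets m) | length-ofSize-false∷ 0 (allSubsets m)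
          | length-ofSize-allSubsets m 0 = refl
  length-ofSize-allSubsets (suc m) (suc k)
    rewrite length-ofSize-++ (suc k) (map (true ∷_) (allSubsets m)) (map (false ∷_) (allSubsets m))
          | length-ofSize-true∷ k (allSubsets m) | length-ofSize-false∷ (suc k) (allSubsets m)
          | length-ofSize-allSubsets m k | length-ofSize-allSubsets m (suc k) = nCk+nC[k+1]≡[n+1]C[k+1] m k

  Wlist-unique : ∀ r → Unique (Wlist r)
  Wlist-unique r = ofSize-unique (half (ℓ r)) (allSubsets-unique (Ucount r))

  ∈-Wlist : ∀ r (W : WVert r) → W ∈ₗ Wlist r
  ∈-Wlist r (Z , ∣Z∣≡k) = ∈-ofSize (half (ℓ r)) (∈-allSubsets Z) ∣Z∣≡k

  uset-injective : ∀ r {i j} → uset r i ≡ uset r j → i ≡ j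
  uset-injective r {i} {j} eq = Unique⇒lookup-injective (ofSize-unique r (allSubsets-unique (qsize r))) i j (Sized-≡ eq)

  Feasible⇒lookup : ∀ {r S₀} {A : Vertex r → Bool} → Feasible r S₀ A → ∀ q → A (qv q) ≡ lookup S₀ q
  Feasible⇒lookup {S₀ = S₀} (_ , S₀⊆A , A∩Q₀⊆S₀) q with lookup S₀ q in eq
  ... | true = S₀⊆A q (Vec.lookup⇒[]= q S₀ eq)
  ... | false = A∩Q₀⊆S₀ q (λ q∈S₀ → contradiction (trans (sym (Vec.[]=⇒lookup q∈S₀)) eq) λ ())

  module MinCut (r' : ℕ) (α : ℚ) where

    r : ℕ
    r = suc r'

    Cut : Set
    Cut = Vertex r → Bool

    U : ℕ
    U = Ucount r

    ρ β h : ℚ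
    ρ = 1ℤ / r
    β = (ρ + ρ * ρ) * α
    h = ℕtoℚ (half (ℓ r) ∸ 1)

    cUQ : Fin U → Fin (qsize r) → ℚ
    cUQ i q = if lookup (uset r i) q then (1ℚ + ρ + ρ * ρ) * α else α

    cUW : Fin U → WVert r → ℚ
    cUW i W = if lookup (proj₁ W) i then 1ℚ else 0ℚ

    -- cutCost r α A unfolds to Σᵢ qRow A (A (uv i)) i + Σᵢ wRow A (A (uv i)) i + xPart A.
    qRow wRow : Cut → Bool → Fin U → ℚ
    qRow A b i = sumFin (λ q → cross b (A (qv q)) (cUQ i q))
    wRow A b i = sumℚ (map (λ W → cross b (A (wv W)) (cUW i W)) (Wlist r))

    xPart : Cut → ℚ
    xPart A = sumℚ (map (λ W → cross (A (wv W)) (A xv) h) (Wlist r))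

    -- the cost of the edges at u_i, resp. w_W, if that vertex is put on side b (true = in A)
    uCost : Cut → Fin U → Bool → ℚ
    uCost A i b = qRow A b i + wRow A b i

    wCost : Cut → WVert r → Bool → ℚ
    wCost A W b = sumFin (λ i → cross (A (uv i)) b (cUW i W)) + cross b (A xv) h

    toggleU : Fin U → Cut → Cut
    toggleU j A (uv i) with i Fin.≟ j
    ... | yes _ = not (A (uv i))
    ... | no _ = A (uv i)
    toggleU j A v = A v

    toggleU-self : ∀ j A → toggleU j A (uv j) ≡ not (A (uv j))
    toggleU-self j A with j Fin.≟ j
    ... | yes _ = refl
    ... | no j≢j = contradiction refl j≢j

    toggleU-other : ∀ {i j} A → i ≢ j → toggleU j A (uv i) ≡ A (uv i)
    toggleU-other {i} {j} A i≢j with i Fin.≟ j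
    ... | yes i≡j = contradiction i≡j i≢j
    ... | no _ = refl

    toggleW : WVert r → Cut → Cut
    toggleW W₀ A (wv W) with Sized-≟ W W₀
    ... | yes _ = not (A (wv W))
    ... | no _ = A (wv W)
    toggleW W₀ A v = A v

    toggleW-self : ∀ W A → toggleW W A (wv W) ≡ not (A (wv W))
    toggleW-self W A with Sized-≟ W W
    ... | yes _ = refl
    ... | no W≢W = contradiction refl W≢W

    toggleW-other : ∀ {W W₀} A → W ≢ W₀ → toggleW W₀ A (wv W) ≡ A (wv W)
    toggleW-other {W} {W₀} A W≢W₀ with Sized-≟ W W₀
    ... | yes W≡W₀ = contradiction W≡W₀ W≢W₀
    ... | no _ = refl

    cutCost-toggleU : ∀ j A → cutCost r α (toggleU j A) ≡ cutCost r α A + (uCost A j (not (A (uv j))) - uCost A j (A (uv j)))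
    cutCost-toggleU j A = begin
      cutCost r α (toggleU j A)                                        ≡⟨ cong₂ (λ x y → x + y + xPart A) (sum-toggle (qRow A)) (sum-toggle (wRow A)) ⟩
      (Q + (qRow A (not a) j - qRow A a j)) + (W + (wRow A (not a) j - wRow A a j)) + xPart A
                                                                        ≡⟨ shuffle Q W (xPart A) (qRow A (not a) j) (qRow A a j) (wRow A (not a) j) (wRow A a j) ⟩
      cutCost r α A + (uCost A j (not a) - uCost A j a)                ∎
      where
      open ≡-Reasoning
      a : Bool
      a = A (uv j)
      Q W : ℚ
      Q = sumFin (λ i → qRow A (A (uv i)) i)
      W = sumFin (λ i → wRow A (A (uv i)) i)
      sum-toggle : ∀ (F : Bool → Fin U → ℚ) → sumFin (λ i → F (toggleU j A (uv i)) i) ≡ sumFin (λ i → F (A (uv i)) i) + (F (not a) j - F a j)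
      sum-toggle F = trans (sum-update (Unique.allFin⁺ U) (∈-allFin j) (λ i i≢j → cong (λ b → F b i) (toggleU-other A i≢j)))
                           (cong (λ b → sumFin (λ i → F (A (uv i)) i) + (F b j - F a j)) (toggleU-self j A))
      shuffle : ∀ Q W X q q' w w' → (Q + (q - q')) + (W + (w - w')) + X ≡ (Q + W + X) + ((q + w) - (q' + w'))
      shuffle = solve-∀ ℚ-ring

    cutCost-toggleW : ∀ W₀ A → cutCost r α (toggleW W₀ A) ≡ cutCost r α A + (wCost A W₀ (not (A (wv W₀))) - wCost A W₀ (A (wv W₀)))
    cutCost-toggleW W₀ A = begin
      cutCost r α (toggleW W₀ A)                                            ≡⟨ cong₂ (λ x y → Q + x + y) wRows-toggle (sum-toggle (λ b _ → cross b (A xv) h)) ⟩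
      Q + (W + (S (not w) - S w)) + (xPart A + (X (not w) - X w))          ≡⟨ shuffle Q W (xPart A) (S (not w)) (S w) (X (not w)) (X w) ⟩
      cutCost r α A + (wCost A W₀ (not w) - wCost A W₀ w)                  ∎
      where
      open ≡-Reasoning
      w : Bool
      w = A (wv W₀)
      Q W : ℚ
      Q = sumFin (λ i → qRow A (A (uv i)) i)
      W = sumFin (λ i → wRow A (A (uv i)) i)
      S : Bool → ℚ
      S b = sumFin (λ i → cross (A (uv i)) b (cUW i W₀))
      X : Bool → ℚ
      X b = cross b (A xv) h
      sum-toggle : ∀ (F : Bool → WVert r → ℚ) → sumℚ (map (λ W → F (toggleW W₀ A (wv W)) W) (Wlist r)) ≡ sumℚ (map (λ W → F (A (wv W)) W) (Wlist r)) + (F (not w) W₀ - F w W₀)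
      sum-toggle F = trans (sum-update (Wlist-unique r) (∈-Wlist r W₀) (λ W W≢W₀ → cong (λ b → F b W) (toggleW-other A W≢W₀)))
                           (cong (λ b → sumℚ (map (λ W → F (A (wv W)) W) (Wlist r)) + (F b W₀ - F w W₀)) (toggleW-self W₀ A))
      wRows-toggle : sumFin (λ i → wRow (toggleW W₀ A) (A (uv i)) i) ≡ W + (S (not w) - S w)
      wRows-toggle = begin
        sumFin (λ i → wRow (toggleW W₀ A) (A (uv i)) i)                          ≡⟨ sum-cong (λ i → sum-toggle (λ b W → cross (A (uv i)) b (cUW i W))) (allFin U) ⟩
        sumFin (λ i → wRow A (A (uv i)) i + (cross (A (uv i)) (not w) (cUW i W₀) - cross (A (uv i)) w (cUW i W₀)))
                                                                                  ≡⟨ sum-+ _ _ (allFin U) ⟩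
        W + sumFin (λ i → cross (A (uv i)) (not w) (cUW i W₀) - cross (A (uv i)) w (cUW i W₀))
                                                                                  ≡⟨ cong (W +_) (sum-minus _ _ (allFin U)) ⟩
        W + (S (not w) - S w)                                                     ∎
      shuffle : ∀ Q W X s s' x x' → Q + (W + (s - s')) + (X + (x - x')) ≡ (Q + W + X) + ((s + x) - (s' + x'))
      shuffle = solve-∀ ℚ-ring

    Minimal : Subset (qsize r) → Cut → Set
    Minimal S₀ A = (A' : Cut) → Feasible r S₀ A' → cutCost r α A ≤ cutCost r α A'

    module _ {S₀ A} (feasible : Feasible r S₀ A) (minimal : Minimal S₀ A) where

      uCost-minimal : ∀ j → uCost A j (A (uv j)) ≤ uCost A j (not (A (uv j)))
      uCost-minimal j = c≤c+[y-x]⇒x≤y (≤-trans (minimal (toggleU j A) feasible) (≤-reflexive (cutCost-toggleU j A)))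

      wCost-minimal : ∀ W → wCost A W (A (wv W)) ≤ wCost A W (not (A (wv W)))
      wCost-minimal W = c≤c+[y-x]⇒x≤y (≤-trans (minimal (toggleW W A) feasible) (≤-reflexive (cutCost-toggleW W A)))

    R : ℚ
    R = ℕtoℚ r

    Wn : ℚ
    Wn = ℕtoℚ (length (Wlist r))

    1≤R : 1ℚ ≤ R
    1≤R = ℕtoℚ-mono-≤ {1} {r} (ℕ.s≤s ℕ.z≤n)

    0<R : 0ℚ < R
    0<R = <-≤-trans (positive⁻¹ 1ℚ) 1≤R

    0≤ρ : 0ℚ ≤ ρ
    0≤ρ = nonNegative⁻¹ ρ {{normalize-nonNeg 1 r}}

    cUQ-split : ∀ i q → cUQ i q ≡ (if lookup (uset r i) q then α + β else α)
    cUQ-split i q = cong (λ B → if lookup (uset r i) q then B else α) (distrib ρ α)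
      where
      distrib : ∀ ρ α → (1ℚ + ρ + ρ * ρ) * α ≡ α + (ρ + ρ * ρ) * α
      distrib = solve-∀ ℚ-ring

    R*R*β≡R*α+α : R * R * β ≡ R * α + α
    R*R*β≡R*α+α = begin
      R * R * ((ρ + ρ * ρ) * α)                  ≡⟨ expand R ρ α ⟩
      (R * ρ) * R * α + (R * ρ) * (R * ρ) * α    ≡⟨ cong (λ t → t * R * α + t * t * α) (ℕtoℚ-*-inverse r') ⟩
      1ℚ * R * α + 1ℚ * 1ℚ * α                   ≡⟨ simplify R α ⟩
      R * α + α                                  ∎
      where
      open ≡-Reasoning
      expand : ∀ R ρ α → R * R * ((ρ + ρ * ρ) * α) ≡ (R * ρ) * R * α + (R * ρ) * (R * ρ) * α
      expand = solve-∀ ℚ-ring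
      simplify : ∀ R α → 1ℚ * R * α + 1ℚ * 1ℚ * α ≡ R * α + α
      simplify = solve-∀ ℚ-ring

    0≤cUW : ∀ i W → 0ℚ ≤ cUW i W
    0≤cUW i W with lookup (proj₁ W) i
    ... | true = nonNegative⁻¹ 1ℚ
    ... | false = ≤-refl

    cUW≤1 : ∀ i W → cUW i W ≤ 1ℚ
    cUW≤1 i W with lookup (proj₁ W) i
    ... | true = ≤-refl
    ... | false = nonNegative⁻¹ 1ℚ

    0≤wRow : ∀ A b i → 0ℚ ≤ wRow A b i
    0≤wRow A b i = begin
      0ℚ                                     ≡⟨ trans (sum-const 0ℚ (Wlist r)) (*-zeroʳ Wn) ⟨
      sumℚ (map (λ _ → 0ℚ) (Wlist r))        ≤⟨ sum-mono-≤ (λ W → 0≤cross b (A (wv W)) (0≤cUW i W)) (Wlist r) ⟩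
      wRow A b i                             ∎
      where open ≤-Reasoning

    wRow≤Wn : ∀ A b i → wRow A b i ≤ Wn
    wRow≤Wn A b i = begin
      wRow A b i                             ≤⟨ sum-mono-≤ (λ W → ≤-trans (cross≤ b (A (wv W)) (0≤cUW i W)) (cUW≤1 i W)) (Wlist r) ⟩
      sumℚ (map (λ _ → 1ℚ) (Wlist r))        ≡⟨ trans (sum-const 1ℚ (Wlist r)) (*-identityʳ Wn) ⟩
      Wn                                     ∎
      where open ≤-Reasoning

    uCost-prefers : ∀ A b i → qRow A b i + Wn < qRow A (not b) i → uCost A i b < uCost A i (not b)
    uCost-prefers A b i gap = begin-strict
      qRow A b i + wRow A b i                ≤⟨ +-monoʳ-≤ (qRow A b i) (wRow≤Wn A b i) ⟩
      qRow A b i + Wn                        <⟨ gap ⟩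
      qRow A (not b) i                       ≡⟨ +-identityʳ _ ⟨
      qRow A (not b) i + 0ℚ                  ≤⟨ +-monoʳ-≤ (qRow A (not b) i) (0≤wRow A (not b) i) ⟩
      qRow A (not b) i + wRow A (not b) i    ∎
      where open ≤-Reasoning

    -- the terminals of Q₀ on the side opposite to b
    across : Subset (qsize r) → Bool → Subset (qsize r)
    across S₀ true = ∁ S₀
    across S₀ false = S₀

    qRow-formula : ∀ {S₀ A} → Feasible r S₀ A → ∀ b i →
                   qRow A b i ≡ ℕtoℚ ∣ across S₀ b ∣ * α + ℕtoℚ ∣ uset r i ∩ across S₀ b ∣ * β
    qRow-formula {S₀} {A} feasible b i = begin
      qRow A b i
        ≡⟨ sum-cong (λ q → trans (cong₂ (cross b) (Feasible⇒lookup {r} {S₀} {A} feasible q) (cUQ-split i q)) (cross-across b q)) (allFin _) ⟩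
      sumFin (λ q → if lookup (across S₀ b) q then (if lookup (uset r i) q then α + β else α) else 0ℚ)
        ≡⟨ sumFin-if-if (across S₀ b) (uset r i) α β ⟩
      ℕtoℚ ∣ across S₀ b ∣ * α + ℕtoℚ ∣ uset r i ∩ across S₀ b ∣ * β ∎
      where
      open ≡-Reasoning
      cross-across : ∀ b q {c} → cross b (lookup S₀ q) c ≡ (if lookup (across S₀ b) q then c else 0ℚ)
      cross-across true q {c} = cong (λ t → if t then c else 0ℚ) (sym (Vec.lookup-map q not S₀))
      cross-across false q = refl

    module _ (α-large : ℕtoℚ (r ℕ.* r ℕ.* ℓ r ℕ.* (ℓ r C half (ℓ r))) < α) where

      0≤α : 0ℚ ≤ α
      0≤α = ≤-trans (0≤ℕtoℚ (r ℕ.* r ℕ.* ℓ r ℕ.* (ℓ r C half (ℓ r)))) (<⇒≤ α-large)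

      0≤β : 0ℚ ≤ β
      0≤β = 0≤* (+-mono-≤ 0≤ρ (0≤* 0≤ρ 0≤ρ)) 0≤α

      length-Wlist : length (Wlist r) ≡ ℓ r C half (ℓ r)
      length-Wlist = trans (length-ofSize-allSubsets U (half (ℓ r))) (cong (_C half (ℓ r)) (length-ofSize-allSubsets (qsize r) r))

      R*R*Wn<α : R * R * Wn < α
      R*R*Wn<α = begin-strict
        R * R * Wn                                     ≡⟨ trans (ℕtoℚ-* (r ℕ.* r) (length (Wlist r))) (cong (_* Wn) (ℕtoℚ-* r r)) ⟨
        ℕtoℚ (r ℕ.* r ℕ.* length (Wlist r))            ≤⟨ ℕtoℚ-mono-≤ r*r*|W|≤ ⟩
        ℕtoℚ (r ℕ.* r ℕ.* ℓ r ℕ.* (ℓ r C half (ℓ r)))   <⟨ α-large ⟩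
        α                                              ∎
        where
        open ≤-Reasoning
        r*r*|W|≤ : r ℕ.* r ℕ.* length (Wlist r) ℕ.≤ r ℕ.* r ℕ.* ℓ r ℕ.* (ℓ r C half (ℓ r))
        r*r*|W|≤ = ℕ.≤-trans (ℕ.≤-reflexive (cong (r ℕ.* r ℕ.*_) length-Wlist))
          (ℕ.*-monoˡ-≤ (ℓ r C half (ℓ r)) (ℕ.m≤m*n (r ℕ.* r) (ℓ r) {{ℕ.>-nonZero (ℕ.<-≤-trans (ℕ.s≤s ℕ.z≤n) (2≤ℓ r'))}}))

      R*Wn<α : R * Wn < α
      R*Wn<α = begin-strict
        R * Wn          ≡⟨ *-identityˡ (R * Wn) ⟨
        1ℚ * (R * Wn)   ≤⟨ *-monoʳ-≤-nonNeg (R * Wn) {{nonNegative (0≤* (<⇒≤ 0<R) (0≤ℕtoℚ (length (Wlist r))))}} 1≤R ⟩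
        R * (R * Wn)    ≡⟨ *-assoc R R Wn ⟨
        R * R * Wn      <⟨ R*R*Wn<α ⟩
        α               ∎
        where open ≤-Reasoning

      gap-at-S₀ : (1ℚ + R) * α + 0ℚ * β + Wn < R * α + R * β
      gap-at-S₀ = *-cancelˡ-<-nonNeg R {{nonNegative (<⇒≤ 0<R)}} (begin-strict
        R * ((1ℚ + R) * α + 0ℚ * β + Wn)   ≡⟨ expand R α β Wn ⟩
        R * R * α + R * α + R * Wn          <⟨ +-monoʳ-< (R * R * α + R * α) R*Wn<α ⟩
        R * R * α + R * α + α               ≡⟨ +-assoc (R * R * α) (R * α) α ⟩
        R * R * α + (R * α + α)             ≡⟨ cong (R * R * α +_) R*R*β≡R*α+α ⟨
        R * R * α + R * R * β               ≡⟨ factor R α β ⟩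
        R * (R * α + R * β)                 ∎)
        where
        open ≤-Reasoning
        expand : ∀ R α β W → R * ((1ℚ + R) * α + 0ℚ * β + W) ≡ R * R * α + R * α + R * W
        expand = solve-∀ ℚ-ring
        factor : ∀ R α β → R * R * α + R * R * β ≡ R * (R * α + R * β)
        factor = solve-∀ ℚ-ring

      gap-off-S₀ : ∀ {D D'} → 1ℚ + D ≤ R → 0ℚ ≤ D' → R * α + D * β + Wn < (1ℚ + R) * α + D' * β
      gap-off-S₀ {D} {D'} 1+D≤R 0≤D' = begin-strict
        R * α + D * β + Wn       ≡⟨ +-assoc (R * α) (D * β) Wn ⟩
        R * α + (D * β + Wn)     <⟨ +-monoʳ-< (R * α) Dβ+Wn<α ⟩
        R * α + α                ≡⟨ collect R α ⟩
        (1ℚ + R) * α             ≡⟨ +-identityʳ _ ⟨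
        (1ℚ + R) * α + 0ℚ        ≤⟨ +-monoʳ-≤ ((1ℚ + R) * α) (0≤* 0≤D' 0≤β) ⟩
        (1ℚ + R) * α + D' * β    ∎
        where
        open ≤-Reasoning
        collect : ∀ R α → R * α + α ≡ (1ℚ + R) * α
        collect = solve-∀ ℚ-ring
        expand : ∀ R D β W → R * R * (D * β + W) ≡ D * (R * R * β) + R * R * W
        expand = solve-∀ ℚ-ring
        regroup : ∀ D R α → D * (R * α + α) + α ≡ (1ℚ + D) * (R * α + α) - R * α
        regroup = solve-∀ ℚ-ring
        contract : ∀ R α → R * (R * α + α) - R * α ≡ R * R * α
        contract = solve-∀ ℚ-ring
        Dβ+Wn<α : D * β + Wn < α
        Dβ+Wn<α = *-cancelˡ-<-nonNeg (R * R) {{nonNegative (0≤* (<⇒≤ 0<R) (<⇒≤ 0<R))}} (begin-strict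
          R * R * (D * β + Wn)              ≡⟨ expand R D β Wn ⟩
          D * (R * R * β) + R * R * Wn      <⟨ +-monoʳ-< (D * (R * R * β)) R*R*Wn<α ⟩
          D * (R * R * β) + α               ≡⟨ cong (λ t → D * t + α) R*R*β≡R*α+α ⟩
          D * (R * α + α) + α               ≡⟨ regroup D R α ⟩
          (1ℚ + D) * (R * α + α) - R * α    ≤⟨ +-monoˡ-≤ (- (R * α)) (*-monoʳ-≤-nonNeg (R * α + α) {{nonNegative 0≤Rα+α}} 1+D≤R) ⟩
          R * (R * α + α) - R * α           ≡⟨ contract R α ⟩
          R * R * α                         ∎)
          where
          0≤Rα+α : 0ℚ ≤ R * α + α
          0≤Rα+α = +-mono-≤ (0≤* (<⇒≤ 0<R) 0≤α) 0≤α

      module _ {S₀ A} (∣S₀∣≡r : ∣ S₀ ∣ ≡ r) (feasible : Feasible r S₀ A) (minimal : Minimal S₀ A) where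

        ∣∁S₀∣≡1+r : ∣ ∁ S₀ ∣ ≡ suc r
        ∣∁S₀∣≡1+r = begin
          ∣ ∁ S₀ ∣             ≡⟨ ∣∁p∣≡n∸∣p∣ S₀ ⟩
          qsize r ∸ ∣ S₀ ∣     ≡⟨ cong (qsize r ∸_) ∣S₀∣≡r ⟩
          suc (2 ℕ.* r) ∸ r    ≡⟨ cong (_∸ r) (ℕ.+-suc r (r ℕ.+ 0)) ⟨
          r ℕ.+ suc (r ℕ.+ 0) ∸ r   ≡⟨ ℕ.m+n∸m≡n r _ ⟩
          suc (r ℕ.+ 0)        ≡⟨ cong suc (ℕ.+-identityʳ r) ⟩
          suc r                ∎
          where open ≡-Reasoning

        qRow≡ : ∀ b i {m k} → ∣ across S₀ b ∣ ≡ m → ∣ uset r i ∩ across S₀ b ∣ ≡ k → qRow A b i ≡ ℕtoℚ m * α + ℕtoℚ k * β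
        qRow≡ b i refl refl = qRow-formula {S₀} {A} feasible b i

        u-own-inside : ∀ i → uset r i ≡ S₀ → A (uv i) ≡ true
        u-own-inside i uᵢ≡S₀ = minimal-side (uCost A i) (A (uv i)) true (uCost-minimal {S₀} {A} feasible minimal i) (uCost-prefers A true i gap)
          where
          ∣uᵢ∩∁S₀∣≡0 : ∣ uset r i ∩ ∁ S₀ ∣ ≡ 0
          ∣uᵢ∩∁S₀∣≡0 = trans (cong (λ s → ∣ s ∩ ∁ S₀ ∣) uᵢ≡S₀) (trans (cong ∣_∣ (∩-inverseʳ S₀)) (∣⊥∣≡0 (qsize r)))
          ∣uᵢ∩S₀∣≡r : ∣ uset r i ∩ S₀ ∣ ≡ r
          ∣uᵢ∩S₀∣≡r = trans (cong (λ s → ∣ s ∩ S₀ ∣) uᵢ≡S₀) (trans (cong ∣_∣ (∩-idem S₀)) ∣S₀∣≡r)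
          gap : qRow A true i + Wn < qRow A false i
          gap = begin-strict
            qRow A true i + Wn                 ≡⟨ cong (_+ Wn) (qRow≡ true i ∣∁S₀∣≡1+r ∣uᵢ∩∁S₀∣≡0) ⟩
            ℕtoℚ (suc r) * α + 0ℚ * β + Wn     ≡⟨ cong (λ x → x * α + 0ℚ * β + Wn) (ℕtoℚ-suc r) ⟩
            (1ℚ + R) * α + 0ℚ * β + Wn         <⟨ gap-at-S₀ ⟩
            R * α + R * β                      ≡⟨ qRow≡ false i ∣S₀∣≡r ∣uᵢ∩S₀∣≡r ⟨
            qRow A false i                     ∎
            where open ≤-Reasoning

        u-other-outside : ∀ j → uset r j ≢ S₀ → A (uv j) ≡ false
        u-other-outside j uⱼ≢S₀ = minimal-side (uCost A j) (A (uv j)) false (uCost-minimal {S₀} {A} feasible minimal j) (uCost-prefers A false j gap)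
          where
          ∣uⱼ∣≡r : ∣ uset r j ∣ ≡ r
          ∣uⱼ∣≡r = proj₂ (List.lookup (Ulist r) j)
          1+D≤R : 1ℚ + ℕtoℚ ∣ uset r j ∩ S₀ ∣ ≤ R
          1+D≤R = begin
            1ℚ + ℕtoℚ ∣ uset r j ∩ S₀ ∣     ≡⟨ ℕtoℚ-suc ∣ uset r j ∩ S₀ ∣ ⟨
            ℕtoℚ (suc ∣ uset r j ∩ S₀ ∣)    ≤⟨ ℕtoℚ-mono-≤ (ℕ.≤-trans (∣p∩q∣<∣p∣ (uset r j) S₀ (trans ∣uⱼ∣≡r (sym ∣S₀∣≡r)) uⱼ≢S₀) (ℕ.≤-reflexive ∣uⱼ∣≡r)) ⟩
            R                                ∎
            where open ≤-Reasoning
          D' : ℚ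
          D' = ℕtoℚ ∣ uset r j ∩ ∁ S₀ ∣
          gap : qRow A false j + Wn < qRow A true j
          gap = begin-strict
            qRow A false j + Wn                        ≡⟨ cong (_+ Wn) (qRow≡ false j ∣S₀∣≡r refl) ⟩
            R * α + ℕtoℚ ∣ uset r j ∩ S₀ ∣ * β + Wn    <⟨ gap-off-S₀ {ℕtoℚ ∣ uset r j ∩ S₀ ∣} {D'} 1+D≤R (0≤ℕtoℚ ∣ uset r j ∩ ∁ S₀ ∣) ⟩
            (1ℚ + R) * α + D' * β                      ≡⟨ cong (λ x → x * α + D' * β) (ℕtoℚ-suc r) ⟨
            ℕtoℚ (suc r) * α + D' * β                  ≡⟨ qRow≡ true j ∣∁S₀∣≡1+r refl ⟨
            qRow A true j                              ∎
            where open ≤-Reasoning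

    half-ℓ≡1+h : ℕtoℚ (half (ℓ r)) ≡ 1ℚ + h
    half-ℓ≡1+h = begin
      ℕtoℚ (half (ℓ r))                  ≡⟨ cong ℕtoℚ (ℕ.m+[n∸m]≡n {1} (/-monoˡ-≤ 2 (2≤ℓ r'))) ⟨
      ℕtoℚ (suc (half (ℓ r) ∸ 1))        ≡⟨ ℕtoℚ-suc (half (ℓ r) ∸ 1) ⟩
      1ℚ + h                             ∎
      where open ≡-Reasoning

    module _ {A : Cut} {i₀ : Fin U} (u₀-inside : A (uv i₀) ≡ true) (others-outside : ∀ j → j ≢ i₀ → A (uv j) ≡ false)
             (x-inside : A xv ≡ true) (W : WVert r) where

      c₀ : ℚ
      c₀ = cUW i₀ W

      sum-cross-U : ∀ b → sumFin (λ i → cross (A (uv i)) b (cUW i W)) ≡ sumFin (λ i → cross false b (cUW i W)) + (cross true b c₀ - cross false b c₀)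
      sum-cross-U b = trans (sum-update (Unique.allFin⁺ U) (∈-allFin i₀) (λ j j≢i₀ → cong (λ a → cross a b (cUW j W)) (others-outside j j≢i₀)))
                            (cong (λ a → sumFin (λ i → cross false b (cUW i W)) + (cross a b c₀ - cross false b c₀)) u₀-inside)

      wCost-true : wCost A W true ≡ (1ℚ + h) - c₀
      wCost-true = begin
        wCost A W true                                                  ≡⟨ cong₂ _+_ (sum-cross-U true) (cong (λ x → cross true x h) x-inside) ⟩
        sumFin (λ i → cUW i W) + (0ℚ - c₀) + 0ℚ                         ≡⟨ cong (λ s → s + (0ℚ - c₀) + 0ℚ) sum-cUW ⟩
        (1ℚ + h) + (0ℚ - c₀) + 0ℚ                                       ≡⟨ simplify (1ℚ + h) c₀ ⟩
        (1ℚ + h) - c₀                                                   ∎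
        where
        open ≡-Reasoning
        sum-cUW : sumFin (λ i → cUW i W) ≡ 1ℚ + h
        sum-cUW = trans (sumFin-select (proj₁ W) 1ℚ) (trans (*-identityʳ (ℕtoℚ ∣ proj₁ W ∣)) (trans (cong ℕtoℚ (proj₂ W)) half-ℓ≡1+h))
        simplify : ∀ s c → s + (0ℚ - c) + 0ℚ ≡ s - c
        simplify = solve-∀ ℚ-ring

      wCost-false : wCost A W false ≡ c₀ + h
      wCost-false = begin
        wCost A W false                                                 ≡⟨ cong₂ _+_ (sum-cross-U false) (cong (λ x → cross false x h) x-inside) ⟩
        sumℚ (map (λ _ → 0ℚ) (allFin U)) + (c₀ - 0ℚ) + h               ≡⟨ cong (λ s → s + (c₀ - 0ℚ) + h) (trans (sum-const 0ℚ (allFin U)) (*-zeroʳ (ℕtoℚ (length (allFin U))))) ⟩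
        0ℚ + (c₀ - 0ℚ) + h                                              ≡⟨ simplify c₀ h ⟩
        c₀ + h                                                          ∎
        where
        open ≡-Reasoning
        simplify : ∀ c h → 0ℚ + (c - 0ℚ) + h ≡ c + h
        simplify = solve-∀ ℚ-ring

      -- The two placements of w_W differ in cost by exactly 1, in favour of the side of u_{S₀}.
      wCost-prefers : wCost A W (lookup (proj₁ W) i₀) < wCost A W (not (lookup (proj₁ W) i₀))
      wCost-prefers with lookup (proj₁ W) i₀ in u₀∈Z
      ... | true = begin-strict
        wCost A W true     ≡⟨ wCost-true ⟩
        (1ℚ + h) - c₀      ≡⟨ cong (λ c → (1ℚ + h) - c) c₀≡1 ⟩
        (1ℚ + h) - 1ℚ      ≡⟨ cancel h ⟩
        h                  <⟨ p<1+p h ⟩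
        1ℚ + h             ≡⟨ cong (_+ h) c₀≡1 ⟨
        c₀ + h             ≡⟨ wCost-false ⟨
        wCost A W false    ∎
        where
        open ≤-Reasoning
        c₀≡1 : c₀ ≡ 1ℚ
        c₀≡1 = cong (λ b → if b then 1ℚ else 0ℚ) u₀∈Z
        cancel : ∀ h → (1ℚ + h) - 1ℚ ≡ h
        cancel = solve-∀ ℚ-ring
      ... | false = begin-strict
        wCost A W false    ≡⟨ wCost-false ⟩
        c₀ + h             ≡⟨ cong (_+ h) c₀≡0 ⟩
        0ℚ + h             ≡⟨ +-identityˡ h ⟩
        h                  <⟨ p<1+p h ⟩
        1ℚ + h             ≡⟨ +-identityʳ (1ℚ + h) ⟨
        (1ℚ + h) - 0ℚ      ≡⟨ cong (λ c → (1ℚ + h) - c) c₀≡0 ⟨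
        (1ℚ + h) - c₀      ≡⟨ wCost-true ⟨
        wCost A W true     ∎
        where
        open ≤-Reasoning
        c₀≡0 : c₀ ≡ 0ℚ
        c₀≡0 = cong (λ b → if b then 1ℚ else 0ℚ) u₀∈Z

open import Data.Bool using (Bool; true; false)
open import Data.Nat using (ℕ; NonZero; _*_; _%_; zero; suc)
open import Data.Nat.Combinatorics using (_C_)
open import Data.Fin using (Fin)
open import Data.Fin.Subset using (Subset; ∣_∣; _∈_)
open import Data.Rational using (ℚ; _<_; _≤_)
open import Data.Product using (proj₁)
open import Data.Vec using (lookup)
import Data.Vec.Properties as Vec
open import Function.Bundles using (_⇔_; mk⇔)
open import Relation.Binary.PropositionalEquality using (_≡_; _≢_; sym; trans)
open Lemmas using (minimal-side; uset-injective; module MinCut)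

-- The hypothesis r ≡ 2 (mod 4) only makes ℓ even in the paper; the argument needs ℓ ≥ 2 alone.
lemma10 : (r : ℕ) .{{_ : NonZero r}} → r % 4 ≡ 2
    → (α : ℚ) → ℕtoℚ (r * r * ℓ r * (ℓ r C half (ℓ r))) < α
    → (S₀ : Subset (qsize r)) → ∣ S₀ ∣ ≡ r
    → (A : Vertex r → Bool) → Feasible r S₀ A
    → ((A' : Vertex r → Bool) → Feasible r S₀ A' → cutCost r α A ≤ cutCost r α A')
    → (i : Fin (Ucount r)) → uset r i ≡ S₀
    → (W : WVert r) → (A (wv W) ≡ true ⇔ i ∈ proj₁ W)
lemma10 zero {{()}} _ α α-large S₀ ∣S₀∣≡r A feasible minimal i uᵢ≡S₀ W
lemma10 (suc r') _ α α-large S₀ ∣S₀∣≡r A feasible minimal i uᵢ≡S₀ W =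
  mk⇔ (λ wW∈A → Vec.lookup⇒[]= i (proj₁ W) (trans (sym w-side) wW∈A)) (λ i∈Z → trans w-side (Vec.[]=⇒lookup i∈Z))
  where
  open MinCut r' α
  others-outside : ∀ j → j ≢ i → A (uv j) ≡ false
  others-outside j j≢i = u-other-outside α-large {S₀} {A} ∣S₀∣≡r feasible minimal j
    (λ uⱼ≡S₀ → j≢i (uset-injective r (trans uⱼ≡S₀ (sym uᵢ≡S₀))))
  w-side : A (wv W) ≡ lookup (proj₁ W) i
  w-side = minimal-side (wCost A W) (A (wv W)) (lookup (proj₁ W) i) (wCost-minimal {S₀} {A} feasible minimal W)
    (wCost-prefers {A} {i} (u-own-inside α-large {S₀} {A} ∣S₀∣≡r feasible minimal i uᵢ≡S₀) others-outside (proj₁ feasible) W)
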